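{- Let $\mathcal{H}$ be a hereditary family of graphs, let $k\in\mathbb{N}$ and let $\alpha(k)\in\mathbb{N}$. Let $G$ be an $(\alpha(k),k)$-unbreakable graph and let $(T,\chi,L)$ be any $\mathcal{H}$-elimination decomposition of $G$ of depth at most $k$ (resp. any $\mathcal{H}$-tree decomposition of $G$ of width at most $k-1$). Then one of the following holds: (1) $|V(G)|\le 3(\alpha(k)+k)$, or (2) there is exactly one connected component $C^*$ of $G[L]$ that has at least $\alpha(k)$ vertices, and $|V(G)\setminus V(C^*)|\le\alpha(k)+k$.
   Context: A separation of $G$ is a pair $(X,Y)$ with $X\cup Y=V(G)$ and no edge between $X\setminus Y$ and $Y\setminus X$; its order is $|X\cap Y|$. $G$ is $(s,c)$-breakable if it has a separation $(X,Y)$ of order at most $c$ with $|X\setminus Y|\ge s$ and $|Y\setminus X|\ge s$; otherwise it is $(s,c)$-unbreakable. Hereditary: closed under induced subgraphs. An $\mathcal{H}$-elimination decomposition of $G$ is $(T,\chi,L)$ with $T$ a rooted forest, $\chi:V(T)\to2^{V(G)}$, $L\subseteq V(G)$: internal nodes have $|\chi(t)|\le1$ and $\chi(t)\cap L=\emptyset$; the bags partition $V(G)$; endpoints of each edge lie in bags of nodes in ancestor–descendant relation; each leaf $t$ has $\chi(t)\subseteq L$ and $G[\chi(t)]\in\mathcal{H}$; depth = maximum number of edges on a root-to-leaf path. An $\mathcal{H}$-tree decomposition is $(T,\chi,L)$ with $T$ a rooted tree such that the nodes whose bags contain any given vertex form a non-empty connected subtree, every edge lies in some bag, every $v\in L$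 lies in a unique bag and that node is a leaf, and $G[\chi(t)\cap L]\in\mathcal{H}$ for every node $t$; width $=\max(0,\max_t|\chi(t)\setminus L|-1)$. -}

module Defs where

open import Data.Bool using (Bool; true; false)
open import Data.Nat using (ℕ; zero; suc; _+_; _*_; _∸_; _≤_; _⊔_)
open import Data.Fin using (Fin)
open import Data.Fin.Subset using (Subset; _∈_; _∉_; _⊆_; _∩_; _∪_; _─_; ∣_∣; Nonempty)
open import Data.List using (List; foldr; map; allFin)
open import Data.Maybe using (Maybe; just; nothing)
open import Data.Product using (Σ; ∃; _×_; _,_)
open import Data.Sum using (_⊎_)
open import Relation.Binary.PropositionalEquality using (_≡_; _≢_)
open import Relation.Nullary using (¬_)
open import Function.Definitions using (Injective)

record Graph : Set where
  field
    n     : ℕ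
    adj   : Fin n → Fin n → Bool
    sym   : ∀ u v → adj u v ≡ adj v u
    irr   : ∀ v → adj v v ≡ false
open Graph public

Edge : (G : Graph) → Fin (n G) → Fin (n G) → Set
Edge G u v = adj G u v ≡ true

-- induced subgraph along an injective map (this also covers relabelling)
pullback : (G : Graph) {m : ℕ} → (Fin m → Fin (n G)) → Graph
pullback G {m} f = record
  { n = m ; adj = λ i j → adj G (f i) (f j)
  ; sym = λ i j → sym G (f i) (f j) ; irr = λ i → irr G (f i) }

Family : Set₁
Family = Graph → Set

Hereditary : Family → Set
Hereditary ℋ = ∀ (G : Graph) {m : ℕ} (f : Fin m → Fin (n G)) →
  Injective _≡_ _≡_ f → ℋ G → ℋ (pullback G f)

InducedIn : Family → (G : Graph) → Subset (n G) → Set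
InducedIn ℋ G X = Σ ℕ λ m → Σ (Fin m → Fin (n G)) λ f →
  Injective _≡_ _≡_ f × (∀ v → v ∈ X → ∃ λ i → f i ≡ v) ×
  (∀ i → f i ∈ X) × ℋ (pullback G f)

IsSeparation : (G : Graph) → Subset (n G) → Subset (n G) → Set
IsSeparation G X Y =
  (∀ v → v ∈ X ∪ Y) ×
  (∀ u v → u ∈ X ─ Y → v ∈ Y ─ X → ¬ Edge G u v)

Breakable : ℕ → ℕ → Graph → Set
Breakable s c G = Σ (Subset (n G)) λ X → Σ (Subset (n G)) λ Y →
  IsSeparation G X Y × ∣ X ∩ Y ∣ ≤ c × s ≤ ∣ X ─ Y ∣ × s ≤ ∣ Y ─ X ∣

Unbreakable : ℕ → ℕ → Graph → Set
Unbreakable s c G = ¬ Breakable s c G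

data WalkIn (G : Graph) (S : Subset (n G)) : Fin (n G) → Fin (n G) → Set where
  here : ∀ {v} → v ∈ S → WalkIn G S v v
  step : ∀ {u w v} → u ∈ S → Edge G u w → WalkIn G S w v → WalkIn G S u v

IsComponent : (G : Graph) → Subset (n G) → Subset (n G) → Set
IsComponent G L C =
  C ⊆ L × Nonempty C ×
  (∀ u v → u ∈ C → v ∈ C → WalkIn G C u v) ×
  (∀ u v → u ∈ C → v ∈ L → Edge G u v → v ∈ C)

record Forest : Set where
  field
    N      : ℕ
    parent : Fin N → Maybe (Fin N)
open Forest public

-- AncN F k t s : t is reached from s by following k parent edges
data AncN (F : Forest) : ℕ → Fin (N F) → Fin (N F) → Set where
  here : ∀ {t} → AncN F 0 t t
  up   : ∀ {k t s p} → parent F s ≡ just p → AncN F k t p → AncN F (suc k) t s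

Anc : (F : Forest) → Fin (N F) → Fin (N F) → Set
Anc F t s = ∃ λ k → AncN F k t s

Acyclic : Forest → Set
Acyclic F = ∀ t k → ¬ AncN F (suc k) t t

IsLeaf : (F : Forest) → Fin (N F) → Set
IsLeaf F t = ∀ s → parent F s ≢ just t

DepthAtMost : Forest → ℕ → Set
DepthAtMost F d = ∀ k t s → AncN F k t s → k ≤ d

SingleRoot : Forest → Set
SingleRoot F = Σ (Fin (N F)) λ r → parent F r ≡ nothing ×
  (∀ r' → parent F r' ≡ nothing → r' ≡ r)

TreeAdj : (F : Forest) → Fin (N F) → Fin (N F) → Set
TreeAdj F t s = parent F s ≡ just t ⊎ parent F t ≡ just s

data TWalkIn (F : Forest) (P : Fin (N F) → Set) : Fin (N F) → Fin (N F) → Set where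
  here : ∀ {t} → P t → TWalkIn F P t t
  step : ∀ {t u s} → P t → TreeAdj F t u → TWalkIn F P u s → TWalkIn F P t s

record ElimDecomp (ℋ : Family) (G : Graph) : Set where
  field
    forest   : Forest
    acyclic  : Acyclic forest
    χ        : Fin (N forest) → Subset (n G)
    L        : Subset (n G)
    internal : ∀ t → ¬ IsLeaf forest t → ∣ χ t ∣ ≤ 1 × (∀ v → v ∈ χ t → v ∉ L)
    partition : ∀ v → Σ (Fin (N forest)) λ t → v ∈ χ t × (∀ t' → v ∈ χ t' → t' ≡ t)
    edges    : ∀ u v t s → Edge G u v → u ∈ χ t → v ∈ χ s →
               Anc forest t s ⊎ Anc forest s t
    leaves   : ∀ t → IsLeaf forest t → χ t ⊆ L × InducedIn ℋ G (χ t)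
open ElimDecomp public

record TreeDecomp (ℋ : Family) (G : Graph) : Set where
  field
    forest    : Forest
    acyclic   : Acyclic forest
    tree      : SingleRoot forest
    χ         : Fin (N forest) → Subset (n G)
    L         : Subset (n G)
    nonempty  : ∀ v → Σ (Fin (N forest)) λ t → v ∈ χ t
    connected : ∀ v t s → v ∈ χ t → v ∈ χ s → TWalkIn forest (λ u → v ∈ χ u) t s
    edges     : ∀ u v → Edge G u v → Σ (Fin (N forest)) λ t → u ∈ χ t × v ∈ χ t
    leafBag   : ∀ v → v ∈ L → Σ (Fin (N forest)) λ t →
                v ∈ χ t × IsLeaf forest t × (∀ t' → v ∈ χ t' → t' ≡ t)
    induced   : ∀ t → InducedIn ℋ G (χ t ∩ L)
open TreeDecomp public

width : {ℋ : Family} {G : Graph} → TreeDecomp ℋ G → ℕ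
width D = foldr _⊔_ 0 (map (λ t → ∣ χ D t ─ L D ∣) (allFin (N (forest D)))) ∸ 1

Conclusion : (G : Graph) → Subset (n G) → ℕ → ℕ → Set
Conclusion G L a k =
  n G ≤ 3 * (a + k) ⊎
  (Σ (Subset (n G)) λ C →
     IsComponent G L C × a ≤ ∣ C ∣ ×
     (∀ C' → IsComponent G L C' → a ≤ ∣ C' ∣ → C' ≡ C) ×
     n G ∸ ∣ C ∣ ≤ a + k)

-- In an (a, k)-unbreakable graph G, a vertex set W whose outside neighbours lie in a set S of
-- at most k vertices is either small (fewer than a vertices) or large (fewer than a + k vertices
-- outside W), for otherwise (W ∪ S, V ∖ W) breaks G. If G has more than 3(a + k) vertices, a
-- large set has more than 2(a + k) of them, so a union of small sets separated by a common S is
-- small again. Both kinds of decompositions supply such common separators: the subtrees below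
-- the children of a node t are separated by the bags of t and its ancestors (depth ≤ k), or by
-- the non-L part of the bag of t (width < k). Walking down from the root while keeping a large
-- part of G therefore ends in a leaf, whose L-part splits into components of G[L] separated by
-- at most k non-L vertices; one of them has at least a vertices. Each such component is large,
-- hence misses at most a + k vertices, and two disjoint large components do not fit into G.

module Submission where

open import Defs
open import Data.Bool using (true; false)
open import Data.Bool.Properties using () renaming (_≟_ to _≟ᵇ_)
open import Data.Fin using (Fin; zero; suc; toℕ) renaming (_≟_ to _≟ᶠ_)
open import Data.Fin.Properties using (any?; pigeonhole)
open import Data.Fin.Subset
  using (Subset; _∈_; _∉_; _⊆_; _∪_; _∩_; _─_; ∁; ⁅_⁆; ⋃; ∣_∣)
  renaming (⊥ to ∅; ⊤ to full)
open import Data.Fin.Subset.Properties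
open import Data.List using (List; []; _∷_; map; filter; foldr; allFin)
open import Data.List.Membership.Propositional using (find) renaming (_∈_ to _∈ˡ_)
open import Data.List.Membership.Propositional.Properties using (∈-allFin; ∈-map⁺; ∈-map∘filter⁺; ∈-map∘filter⁻)
open import Data.List.Relation.Unary.All as All using (All; []; _∷_)
open import Data.List.Relation.Unary.All.Properties using (¬Any⇒All¬)
open import Data.List.Relation.Unary.Any as Any using (Any; here; there)
open import Data.Maybe using (just; nothing; maybe′)
open import Data.Maybe.Properties using (just-injective) renaming (≡-dec to ≡-decᵐ)
open import Data.Nat
open import Data.Nat.GeneralisedArithmetic using (fold)
open import Data.Nat.Properties
open import Data.Product using (∃; _×_; _,_; proj₁; proj₂)
open import Data.Sum using (_⊎_; inj₁; inj₂; map₁; map₂)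
open import Data.Vec using ([]; _∷_; here; there; tabulate)
open import Data.Vec.Properties using (lookup∘tabulate; []=⇒lookup; lookup⇒[]=)
open import Function using (_∘_; case_of_)
open import Level using (Level)
open import Relation.Binary.PropositionalEquality using (_≡_; refl; cong; subst; trans) renaming (sym to ≡-sym)
open import Relation.Nullary using (¬_; Dec; yes; no; does; ¬?; contradiction)
open import Relation.Nullary.Decidable using (_×-dec_)
open import Relation.Unary using (Pred; Decidable)

private
  variable
    m : ℕ
    p q : Subset m
    x : Fin m
    ℓ : Level

∣p∪q∣≤∣p∣+∣q∣ : (p q : Subset m) → ∣ p ∪ q ∣ ≤ ∣ p ∣ + ∣ q ∣
∣p∪q∣≤∣p∣+∣q∣ []          []          = z≤n
∣p∪q∣≤∣p∣+∣q∣ (true ∷ p)  (true ∷ q)  = s≤s (≤-trans (∣p∪q∣≤∣p∣+∣q∣ p q) (+-monoʳ-≤ ∣ p ∣ (n≤1+n _)))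
∣p∪q∣≤∣p∣+∣q∣ (true ∷ p)  (false ∷ q) = s≤s (∣p∪q∣≤∣p∣+∣q∣ p q)
∣p∪q∣≤∣p∣+∣q∣ (false ∷ p) (true ∷ q)  = ≤-trans (s≤s (∣p∪q∣≤∣p∣+∣q∣ p q)) (≤-reflexive (≡-sym (+-suc ∣ p ∣ ∣ q ∣)))
∣p∪q∣≤∣p∣+∣q∣ (false ∷ p) (false ∷ q) = ∣p∪q∣≤∣p∣+∣q∣ p q

x∈p─q⇒x∉q : x ∈ p ─ q → x ∉ q
x∈p─q⇒x∉q {p = _ ∷ p} {q = true ∷ q}  (there x∈) (there x∈q) = x∈p─q⇒x∉q {p = p} x∈ x∈q
x∈p─q⇒x∉q {p = _ ∷ p} {q = false ∷ q} (there x∈) (there x∈q) = x∈p─q⇒x∉q {p = p} x∈ x∈q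

∣∁p∣+∣p∣≡n : (p : Subset m) → ∣ ∁ p ∣ + ∣ p ∣ ≡ m
∣∁p∣+∣p∣≡n {m} p = trans (cong (_+ ∣ p ∣) (∣∁p∣≡n∸∣p∣ p)) (m∸n+n≡m (∣p∣≤n p))

p⊆∁q⇒∣p∣+∣q∣≤n : {p q : Subset m} → p ⊆ ∁ q → ∣ p ∣ + ∣ q ∣ ≤ m
p⊆∁q⇒∣p∣+∣q∣≤n {q = q} p⊆∁q = ≤-trans (+-monoˡ-≤ ∣ q ∣ (p⊆q⇒∣p∣≤∣q∣ p⊆∁q)) (≤-reflexive (∣∁p∣+∣p∣≡n q))

x∈xs⇒x≤foldr⊔ : ∀ {x xs} → x ∈ˡ xs → x ≤ foldr _⊔_ 0 xs
x∈xs⇒x≤foldr⊔ {xs = y ∷ ys} (here refl) = m≤m⊔n y _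
x∈xs⇒x≤foldr⊔ {xs = y ∷ ys} (there x∈) = ≤-trans (x∈xs⇒x≤foldr⊔ x∈) (m≤n⊔m y _)

m≤o⇒n≤o⇒m+n≤2*o : ∀ {m n o} → m ≤ o → n ≤ o → m + n ≤ 2 * o
m≤o⇒n≤o⇒m+n≤2*o {o = o} m≤o n≤o = ≤-trans (+-mono-≤ m≤o n≤o) (≤-reflexive (cong (o +_) (≡-sym (+-identityʳ o))))

∣∅∣≤ : ∀ c → ∣ ∅ {m} ∣ ≤ c
∣∅∣≤ {m} c = ≤-trans (≤-reflexive (∣⊥∣≡0 m)) z≤n

x∈⋃⁺ : {ps : List (Subset m)} → p ∈ˡ ps → x ∈ p → x ∈ ⋃ ps
x∈⋃⁺ {ps = p ∷ ps} (here refl) x∈p = p⊆p∪q (⋃ ps) x∈p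
x∈⋃⁺ {ps = p ∷ ps} (there p∈) x∈p = q⊆p∪q p (⋃ ps) (x∈⋃⁺ p∈ x∈p)

subset : {P : Pred (Fin m) ℓ} → Decidable P → Subset m
subset P? = tabulate (λ x → does (P? x))

x∈subset⁺ : {P : Pred (Fin m) ℓ} (P? : Decidable P) → P x → x ∈ subset P?
x∈subset⁺ {x = x} P? Px with P? x in eq
... | yes _  = lookup⇒[]= x _ (trans (lookup∘tabulate _ x) (cong does eq))
... | no ¬Px = contradiction Px ¬Px

x∈subset⁻ : {P : Pred (Fin m) ℓ} (P? : Decidable P) → x ∈ subset P? → P x
x∈subset⁻ {x = x} P? x∈ with P? x in eq
... | yes Px = Px
... | no _   with () ← trans (trans (≡-sym (cong does eq)) (≡-sym (lookup∘tabulate _ x))) ([]=⇒lookup x∈)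

module _ (f : Subset m → Subset m) (inflationary : ∀ p → p ⊆ f p) where

  fixed⊎grows : ∀ p → f p ≡ p ⊎ ∣ p ∣ < ∣ f p ∣
  fixed⊎grows p with any? (λ x → x ∈? f p ×-dec ¬? (x ∈? p))
  ... | yes (x , x∈fp , x∉p) = inj₂ (p⊂q⇒∣p∣<∣q∣ (inflationary p , x , x∈fp , x∉p))
  ... | no ∄x = inj₁ (⊆-antisym fp⊆p (inflationary p))
    where
    fp⊆p : f p ⊆ p
    fp⊆p {x} x∈fp with x ∈? p
    ... | yes x∈p = x∈p
    ... | no x∉p  = contradiction (x , x∈fp , x∉p) ∄x

  fold-fixed⊎grows : ∀ p i → f (fold p f i) ≡ fold p f i ⊎ i ≤ ∣ fold p f i ∣
  fold-fixed⊎grows p zero = inj₂ z≤n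
  fold-fixed⊎grows p (suc i) with fold-fixed⊎grows p i
  ... | inj₁ fixed = inj₁ (cong f fixed)
  ... | inj₂ i≤ with fixed⊎grows (fold p f i)
  ...   | inj₁ fixed = inj₁ (cong f fixed)
  ...   | inj₂ grows = inj₂ (≤-<-trans i≤ grows)

  -- Every round before the fixed point adds an element, and Subset m has only m of them.
  fold-fixed : ∀ p → f (fold p f m) ≡ fold p f m
  fold-fixed p with fold-fixed⊎grows p m
  ... | inj₁ fixed = fixed
  ... | inj₂ m≤ = ⊆-antisym (λ _ → subst (_ ∈_) (≡-sym q≡⊤) ∈⊤) (inflationary _)
    where
    q≡⊤ : fold p f m ≡ full
    q≡⊤ = ∣p∣≡n⇒p≡⊤ (≤-antisym (∣p∣≤n (fold p f m)) m≤)

  ⊆-fold : ∀ p i → p ⊆ fold p f i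
  ⊆-fold p zero    = λ x∈ → x∈
  ⊆-fold p (suc i) = λ x∈ → inflationary _ (⊆-fold p i x∈)

record Separates (G : Graph) (S W : Subset (n G)) : Set where
  constructor separates
  field
    leave : ∀ {u w} → u ∈ W → Edge G u w → w ∈ W ⊎ w ∈ S
open Separates public

-- Models the L-part of a leaf bag together with the non-L vertices fencing it off.
record Enclosure (G : Graph) (L : Subset (n G)) (k : ℕ) (W : Subset (n G)) : Set where
  field
    boundary     : Subset (n G)
    ∣boundary∣≤k : ∣ boundary ∣ ≤ k
    separated    : Separates G boundary W
    W⊆L          : W ⊆ L
    boundary∌L   : ∀ {v} → v ∈ boundary → v ∉ L

module _ {G : Graph} where

  private
    variable
      S S′ W W′ C C′ : Subset (n G)
      u v w : Fin (n G)

  Edge-sym : Edge G u w → Edge G w u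
  Edge-sym {u} {w} e = trans (sym G w u) e

  walk-head : WalkIn G S u w → u ∈ S
  walk-head (here u∈S)     = u∈S
  walk-head (step u∈S _ _) = u∈S

  walk-last : WalkIn G S u w → w ∈ S
  walk-last (here w∈S)      = w∈S
  walk-last (step _ _ rest) = walk-last rest

  _++ʷ_ : WalkIn G S u v → WalkIn G S v w → WalkIn G S u w
  here _          ++ʷ rest′ = rest′
  step u∈S e rest ++ʷ rest′ = step u∈S e (rest ++ʷ rest′)

  walk-snoc : WalkIn G S u v → Edge G v w → w ∈ S → WalkIn G S u w
  walk-snoc ρ e w∈S = ρ ++ʷ step (walk-last ρ) e (here w∈S)

  walk-reverse : WalkIn G S u w → WalkIn G S w u
  walk-reverse (here u∈S)        = here u∈S
  walk-reverse (step u∈S e rest) = walk-snoc (walk-reverse rest) (Edge-sym e) u∈S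

  walk-mono : S ⊆ S′ → WalkIn G S u w → WalkIn G S′ u w
  walk-mono S⊆S′ (here u∈S)        = here (S⊆S′ u∈S)
  walk-mono S⊆S′ (step u∈S e rest) = step (S⊆S′ u∈S) e (walk-mono S⊆S′ rest)

  walk-stays : (∀ {u w} → u ∈ W → w ∈ S → Edge G u w → w ∈ W) →
               WalkIn G S u w → u ∈ W → w ∈ W
  walk-stays closed (here _)        u∈W = u∈W
  walk-stays closed (step _ e rest) u∈W = walk-stays closed rest (closed u∈W (walk-head rest) e)

  Separates-∪ : Separates G S W → Separates G S W′ → Separates G S (W ∪ W′)
  Separates-∪ {W = W} {W′ = W′} sep sep′ = separates λ u∈ e → case x∈p∪q⁻ W W′ u∈ of λ where
    (inj₁ u∈W)  → map₁ (p⊆p∪q W′) (leave sep u∈W e)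
    (inj₂ u∈W′) → map₁ (q⊆p∪q W W′) (leave sep′ u∈W′ e)

  module _ {L : Subset (n G)} where

    component-≡ : IsComponent G L C → IsComponent G L C′ → u ∈ C → u ∈ C′ → C ≡ C′
    component-≡ {u = u} (C⊆L , _ , conn , closed) (C′⊆L , _ , conn′ , closed′) u∈C u∈C′ =
      ⊆-antisym (λ {y} y∈C → walk-stays (λ x∈ w∈ → closed′ _ _ x∈ (C⊆L w∈)) (conn u y u∈C y∈C) u∈C′)
                (λ {y} y∈C′ → walk-stays (λ x∈ w∈ → closed _ _ x∈ (C′⊆L w∈)) (conn′ u y u∈C′ y∈C′) u∈C)

    module _ {k : ℕ} (E : Enclosure G L k W) where
      open Enclosure E

      -- A walk in G[L] cannot leave W, as the boundary avoids L.
      component⊆ : IsComponent G L C → u ∈ C → u ∈ W → C ⊆ W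
      component⊆ {u = u} (C⊆L , _ , conn , _) u∈C u∈W {y} y∈C =
        walk-stays stay (conn u y u∈C y∈C) u∈W
        where
        stay : ∀ {x w} → x ∈ W → w ∈ _ → Edge G x w → w ∈ W
        stay x∈W w∈C e with leave separated x∈W e
        ... | inj₁ w∈W = w∈W
        ... | inj₂ w∈S = contradiction (C⊆L w∈C) (boundary∌L w∈S)

      component-separated : IsComponent G L C → u ∈ C → u ∈ W → Separates G boundary C
      component-separated isC@(_ , _ , _ , closed) u∈C u∈W = separates leave-C
        where
        leave-C : ∀ {c w} → c ∈ _ → Edge G c w → w ∈ _ ⊎ w ∈ boundary
        leave-C {c} c∈C e with leave separated (component⊆ isC u∈C u∈W c∈C) e
        ... | inj₁ w∈W = inj₁ (closed c _ c∈C (W⊆L w∈W) e)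
        ... | inj₂ w∈S = inj₂ w∈S

module _ (G : Graph) (L : Subset (n G)) where

  private
    variable
      u v w : Fin (n G)
      W : Subset (n G)

  L-neighbour? : (X : Subset (n G)) → Decidable (λ w → w ∈ L × ∃ λ u → u ∈ X × Edge G u w)
  L-neighbour? X w = w ∈? L ×-dec any? (λ u → u ∈? X ×-dec (adj G u w ≟ᵇ true))

  grow : Subset (n G) → Subset (n G)
  grow X = X ∪ subset (L-neighbour? X)

  grow-inflationary : ∀ X → X ⊆ grow X
  grow-inflationary X = p⊆p∪q _

  grow⁺ : u ∈ W → w ∈ L → Edge G u w → w ∈ grow W
  grow⁺ {W = W} u∈W w∈L e = q⊆p∪q W _ (x∈subset⁺ (L-neighbour? W) (w∈L , _ , u∈W , e))

  grow⁻ : w ∈ grow W → w ∈ W ⊎ (w ∈ L × ∃ λ u → u ∈ W × Edge G u w)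
  grow⁻ {W = W} w∈ = map₂ (x∈subset⁻ (L-neighbour? W)) (x∈p∪q⁻ W _ w∈)

  componentOf : Fin (n G) → Subset (n G)
  componentOf v = fold ⁅ v ⁆ grow (n G)

  v∈componentOf : ∀ v → v ∈ componentOf v
  v∈componentOf v = ⊆-fold grow grow-inflationary ⁅ v ⁆ (n G) (x∈⁅x⁆ v)

  fold-grow⊆L : v ∈ L → ∀ i → fold ⁅ v ⁆ grow i ⊆ L
  fold-grow⊆L v∈L zero    u∈ rewrite x∈⁅y⁆⇒x≡y _ u∈ = v∈L
  fold-grow⊆L v∈L (suc i) u∈ with grow⁻ u∈
  ... | inj₁ u∈′          = fold-grow⊆L v∈L i u∈′
  ... | inj₂ (u∈L , _)    = u∈L

  walk-from-centre : ∀ i → u ∈ fold ⁅ v ⁆ grow i → WalkIn G (fold ⁅ v ⁆ grow i) v u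
  walk-from-centre {v = v} zero u∈ rewrite x∈⁅y⁆⇒x≡y _ u∈ = here (x∈⁅x⁆ v)
  walk-from-centre (suc i) u∈ with grow⁻ u∈
  ... | inj₁ u∈′ = walk-mono (grow-inflationary _) (walk-from-centre i u∈′)
  ... | inj₂ (_ , u′ , u′∈ , e) =
    walk-snoc (walk-mono (grow-inflationary _) (walk-from-centre i u′∈)) e u∈

  componentOf-isComponent : v ∈ L → IsComponent G L (componentOf v)
  componentOf-isComponent {v} v∈L =
    fold-grow⊆L v∈L (n G) , (v , v∈componentOf v) , linked , closed
    where
    linked : ∀ u w → u ∈ componentOf v → w ∈ componentOf v → WalkIn G (componentOf v) u w
    linked u w u∈ w∈ = walk-reverse (walk-from-centre (n G) u∈) ++ʷ walk-from-centre (n G) w∈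
    closed : ∀ u w → u ∈ componentOf v → w ∈ L → Edge G u w → w ∈ componentOf v
    closed u w u∈ w∈L e =
      subst (w ∈_) (fold-fixed grow grow-inflationary ⁅ v ⁆) (grow⁺ u∈ w∈L e)

module _ {F : Forest} where

  private
    variable
      i j : ℕ
      c s t t′ : Fin (N F)

  anc-trans : AncN F i t s → AncN F j s t′ → AncN F (j + i) t t′
  anc-trans a here     = a
  anc-trans a (up e b) = up e (anc-trans a b)

  anc-comparable : AncN F i t s → AncN F j t′ s → Anc F t t′ ⊎ ∃ λ d → AncN F (suc d) t′ t
  anc-comparable here     here     = inj₁ (0 , here)
  anc-comparable here     (up e b) = inj₂ (_ , up e b)
  anc-comparable (up e a) here     = inj₁ (_ , up e a)
  anc-comparable (up e a) (up e′ b) with just-injective (trans (≡-sym e) e′)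
  ... | refl = anc-comparable a b

  anc-via-child : AncN F (suc j) t s → ∃ λ c → parent F c ≡ just t × AncN F j c s
  anc-via-child {s = s} (up e here)        = s , e , here
  anc-via-child         (up e (up e′ a)) with anc-via-child (up e′ a)
  ... | c , e″ , a′ = c , e″ , up e a′

  anc-zero : AncN F 0 t s → s ≡ t
  anc-zero here = refl

  leaf-anc : IsLeaf F t → AncN F j t s → s ≡ t
  leaf-anc leaf here     = refl
  leaf-anc leaf (up e a) with anc-via-child (up e a)
  ... | c , e′ , _ = contradiction e′ (leaf c)

  anc-within? : ∀ f t s → Dec (∃ λ j → j ≤ f × AncN F j t s)
  anc-within? f t s with s ≟ᶠ t
  ... | yes refl = yes (0 , z≤n , here)
  anc-within? zero t s | no s≢t = no λ { (zero , _ , here) → s≢t refl }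
  anc-within? (suc f) t s | no s≢t with parent F s in eq
  ... | nothing = no λ
    { (zero , _ , here) → s≢t refl
    ; (suc _ , _ , up e _) → contradiction (trans (≡-sym eq) e) λ () }
  ... | just p with anc-within? f t p
  ...   | yes (j , j≤f , a) = yes (suc j , s≤s j≤f , up eq a)
  ...   | no ∄a = no λ
    { (zero , _ , here) → s≢t refl
    ; (suc j , s≤s j≤f , up e a) → ∄a (j , j≤f , subst (AncN F j t) (just-injective (trans (≡-sym e) eq)) a) }

  module _ {B : ℕ} (depth : DepthAtMost F B) where

    anc? : ∀ t s → Dec (Anc F t s)
    anc? t s with anc-within? B t s
    ... | yes (j , _ , a) = yes (j , a)
    ... | no ∄a = no λ { (j , a) → ∄a (j , depth j t s a , a) }

    root⊎climb : ∀ f s → (∃ λ r → parent F r ≡ nothing × Anc F r s) ⊎ (∃ λ t → AncN F f t s)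
    root⊎climb zero    s = inj₂ (s , here)
    root⊎climb (suc f) s with parent F s in eq
    ... | nothing = inj₁ (s , eq , 0 , here)
    ... | just p with root⊎climb f p
    ...   | inj₁ (r , r-root , j , a) = inj₁ (r , r-root , suc j , up eq a)
    ...   | inj₂ (t , a)              = inj₂ (t , up eq a)

    root-anc : ∀ s → ∃ λ r → parent F r ≡ nothing × Anc F r s
    root-anc s with root⊎climb (suc B) s
    ... | inj₁ root    = root
    ... | inj₂ (t , a) = contradiction (depth _ t s a) (n≮n B)

    descend : (P : Fin (N F) → Set ℓ) →
              (∀ {t c} → parent F c ≡ just t → P t → ∃ λ c′ → parent F c′ ≡ just t × P c′) →
              P t → ∃ λ t′ → IsLeaf F t′ × P t′
    descend {t = t} P down = go B (here {t = t}) ≤-refl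
      where
      go : ∀ fuel {d t₀ t} → AncN F d t₀ t → B ≤ d + fuel → P t → ∃ λ t′ → IsLeaf F t′ × P t′
      go fuel {d} {t₀} {t} a B≤ Pt with any? (λ c → ≡-decᵐ _≟ᶠ_ (parent F c) (just t))
      ... | no ∄c = t , (λ c e → ∄c (c , e)) , Pt
      ... | yes (_ , e) with down e Pt
      ...   | c , e′ , Pc with fuel
      ...     | zero      = contradiction (≤-trans B≤ (≤-reflexive (+-identityʳ d))) (<⇒≱ (depth _ t₀ c (up e′ a)))
      ...     | suc fuel′ = go fuel′ (up e′ a) (≤-trans B≤ (≤-reflexive (+-suc d fuel′))) Pc

  nodeAt : AncN F j t s → Fin (suc j) → Fin (N F)
  nodeAt {s = s} _        zero    = s
  nodeAt         (up _ a) (suc i) = nodeAt a i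

  nodeAt-anc : (a : AncN F j t s) (i : Fin (suc j)) → AncN F (toℕ i) (nodeAt a i) s
  nodeAt-anc a        zero    = here
  nodeAt-anc (up e a) (suc i) = up e (nodeAt-anc a i)

  nodeAt-proper : (a : AncN F j t s) {i i′ : Fin (suc j)} → i Data.Fin.< i′ →
                  ∃ λ d → AncN F (suc d) (nodeAt a i′) (nodeAt a i)
  nodeAt-proper (up e a) {zero}  {suc i′} _          = toℕ i′ , up e (nodeAt-anc a i′)
  nodeAt-proper (up e a) {suc i} {suc i′} (s≤s i<i′) = nodeAt-proper a i<i′

  -- A chain of j ≥ N F parent steps visits some node twice, closing a cycle.
  acyclic⇒depth : Acyclic F → DepthAtMost F (N F)
  acyclic⇒depth acyclic j t s a with N F ≤? j
  ... | no  N≰j = <⇒≤ (≰⇒> N≰j)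
  ... | yes N≤j with pigeonhole (s≤s N≤j) (nodeAt a)
  ...   | i , i′ , i<i′ , same with nodeAt-proper a i<i′
  ...     | d , cycle = contradiction (subst (AncN F (suc d) (nodeAt a i′)) same cycle) (acyclic _ d)

  module _ {P : Fin (N F) → Set} where

    twalk-head : TWalkIn F P t s → P t
    twalk-head (here Pt)     = Pt
    twalk-head (step Pt _ _) = Pt

    subtree-twalk : parent F c ≡ just t → ¬ P t → TWalkIn F P s t′ → Anc F c s → Anc F c t′
    subtree-twalk e ¬Pt (here _)                c≤s              = c≤s
    subtree-twalk e ¬Pt (step _ (inj₁ e′) rest) (j , a)          = subtree-twalk e ¬Pt rest (suc j , up e′ a)
    subtree-twalk e ¬Pt (step _ (inj₂ e′) rest) (zero , here) with just-injective (trans (≡-sym e) e′)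
    ... | refl = contradiction (twalk-head rest) ¬Pt
    subtree-twalk e ¬Pt (step _ (inj₂ e′) rest) (suc j , up e″ a) with just-injective (trans (≡-sym e″) e′)
    ... | refl = subtree-twalk e ¬Pt rest (j , a)

unbreakable⇒0<s : ∀ {s c} {G : Graph} → Unbreakable s c G → 0 < s
unbreakable⇒0<s {zero} {c} {G} unbreakable = contradiction trivial-break unbreakable
  where
  trivial-break : Breakable 0 c G
  trivial-break = full , ∅ , ((λ _ → x∈p∪q⁺ (inj₁ ∈⊤)) , λ _ _ _ v∈ → contradiction (p─q⊆p ∅ full v∈) ∉⊥)
                , ≤-trans (∣p∩q∣≤∣q∣ (full {n G}) ∅) (∣∅∣≤ {n G} c) , z≤n , z≤n
unbreakable⇒0<s {suc _} _ = s≤s z≤n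

module UnbreakableGraph {a k : ℕ} {G : Graph} (unbreakable : Unbreakable a k G) where

  private
    variable
      S W X : Subset (n G)

  Large : Subset (n G) → Set
  Large W = n G < a + k + ∣ W ∣

  0<a : 0 < a
  0<a = unbreakable⇒0<s {c = k} {G = G} unbreakable

  -- (W ∪ S, ∁ W) is a separation of order at most ∣ S ∣ with sides W and ∁ (W ∪ S).
  small⊎large : ∣ S ∣ ≤ k → Separates G S W → ∣ W ∣ < a ⊎ Large W
  small⊎large {S} {W} ∣S∣≤k sep with a ≤? ∣ W ∣ | a ≤? ∣ ∁ (W ∪ S) ∣
  ... | no  a≰∣W∣ | _      = inj₁ (≰⇒> a≰∣W∣)
  ... | yes a≤∣W∣ | yes a≤ = contradiction breaks unbreakable
    where
    breaks : Breakable a k G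
    breaks = W ∪ S , ∁ W , (cover , no-edge) , ≤-trans (p⊆q⇒∣p∣≤∣q∣ middle) ∣S∣≤k
           , ≤-trans a≤∣W∣ (p⊆q⇒∣p∣≤∣q∣ left) , ≤-trans a≤ (p⊆q⇒∣p∣≤∣q∣ right)
      where
      cover : ∀ v → v ∈ (W ∪ S) ∪ ∁ W
      cover v with v ∈? W
      ... | yes v∈W = x∈p∪q⁺ (inj₁ (p⊆p∪q S v∈W))
      ... | no  v∉W = x∈p∪q⁺ (inj₂ (x∉p⇒x∈∁p v∉W))
      no-edge : ∀ u v → u ∈ (W ∪ S) ─ ∁ W → v ∈ ∁ W ─ (W ∪ S) → ¬ Edge G u v
      no-edge u v u∈ v∈ e with leave sep (x∉∁p⇒x∈p (x∈p─q⇒x∉q u∈)) e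
      ... | inj₁ v∈W = x∈p─q⇒x∉q v∈ (p⊆p∪q S v∈W)
      ... | inj₂ v∈S = x∈p─q⇒x∉q v∈ (q⊆p∪q W S v∈S)
      middle : (W ∪ S) ∩ ∁ W ⊆ S
      middle v∈ with x∈p∩q⁻ (W ∪ S) (∁ W) v∈
      ... | v∈W∪S , v∈∁W with x∈p∪q⁻ W S v∈W∪S
      ...   | inj₁ v∈W = contradiction v∈W (x∈∁p⇒x∉p v∈∁W)
      ...   | inj₂ v∈S = v∈S
      left : W ⊆ (W ∪ S) ─ ∁ W
      left v∈W = x∈p∧x∉q⇒x∈p─q (p⊆p∪q S v∈W) (x∈p⇒x∉∁p v∈W)
      right : ∁ (W ∪ S) ⊆ ∁ W ─ (W ∪ S)
      right v∈ = x∈p∧x∉q⇒x∈p─q (x∉p⇒x∈∁p (x∈∁p⇒x∉p v∈ ∘ p⊆p∪q S)) (x∈∁p⇒x∉p v∈)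
  ... | yes _ | no a≰ = inj₂ (begin-strict
    n G                          ≡⟨ ∣∁p∣+∣p∣≡n (W ∪ S) ⟨
    ∣ ∁ (W ∪ S) ∣ + ∣ W ∪ S ∣    <⟨ +-monoˡ-< ∣ W ∪ S ∣ (≰⇒> a≰) ⟩
    a + ∣ W ∪ S ∣                ≤⟨ +-monoʳ-≤ a (∣p∪q∣≤∣p∣+∣q∣ W S) ⟩
    a + (∣ W ∣ + ∣ S ∣)          ≤⟨ +-monoʳ-≤ a (+-monoʳ-≤ ∣ W ∣ ∣S∣≤k) ⟩
    a + (∣ W ∣ + k)              ≡⟨ cong (a +_) (+-comm ∣ W ∣ k) ⟩
    a + (k + ∣ W ∣)              ≡⟨ +-assoc a k ∣ W ∣ ⟨
    a + k + ∣ W ∣                ∎)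
    where open ≤-Reasoning

  Large-⊆ : W ⊆ X → Large W → Large X
  Large-⊆ W⊆X large-W = <-≤-trans large-W (+-monoʳ-≤ (a + k) (p⊆q⇒∣p∣≤∣q∣ W⊆X))

  Large-full : Large (full {n G})
  Large-full = begin-strict
    n G                     <⟨ +-monoˡ-≤ (n G) (≤-trans 0<a (m≤m+n a k)) ⟩
    a + k + n G             ≡⟨ cong (a + k +_) (∣⊤∣≡n (n G)) ⟨
    a + k + ∣ full {n G} ∣  ∎
    where open ≤-Reasoning

  a≤∣W∣⇒Large : ∣ S ∣ ≤ k → Separates G S W → a ≤ ∣ W ∣ → Large W
  a≤∣W∣⇒Large ∣S∣≤k sep a≤∣W∣ with small⊎large ∣S∣≤k sep
  ... | inj₁ ∣W∣<a = contradiction a≤∣W∣ (<⇒≱ ∣W∣<a)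
  ... | inj₂ large-W = large-W

  ⋃-separated : {Ps : List (Subset (n G))} → All (Separates G S) Ps → Separates G S (⋃ Ps)
  ⋃-separated []           = separates λ u∈⊥ _ → contradiction u∈⊥ ∉⊥
  ⋃-separated (sep ∷ seps) = Separates-∪ sep (⋃-separated seps)

  module _ (3[a+k]<n : 3 * (a + k) < n G) where

    Large⇒2[a+k]<∣W∣ : Large W → 2 * (a + k) < ∣ W ∣
    Large⇒2[a+k]<∣W∣ large-W = +-cancelˡ-< (a + k) _ _ (<-trans 3[a+k]<n large-W)

    -- P ∪ ⋃ Ps is again S-separated, and too small (< 2a vertices) to be large.
    ⋃-small : {Ps : List (Subset (n G))} → ∣ S ∣ ≤ k → All (Separates G S) Ps →
              All (λ P → ∣ P ∣ < a) Ps → ∣ ⋃ Ps ∣ < a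
    ⋃-small _ [] [] = subst (_< a) (≡-sym (∣⊥∣≡0 (n G))) 0<a
    ⋃-small {Ps = P ∷ Ps} ∣S∣≤k (sep ∷ seps) (∣P∣<a ∷ small)
      with small⊎large ∣S∣≤k (Separates-∪ sep (⋃-separated seps))
    ... | inj₁ ∣P∪⋃Ps∣<a = ∣P∪⋃Ps∣<a
    ... | inj₂ large-P∪⋃Ps = contradiction
      (≤-trans (∣p∪q∣≤∣p∣+∣q∣ P (⋃ Ps)) (m≤o⇒n≤o⇒m+n≤2*o (<⇒≤ (≤-trans ∣P∣<a (m≤m+n a k)))
                                               (<⇒≤ (≤-trans (⋃-small ∣S∣≤k seps small) (m≤m+n a k)))))
      (<⇒≱ (Large⇒2[a+k]<∣W∣ {W = P ∪ ⋃ Ps} large-P∪⋃Ps))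

    large-in : {Ps : List (Subset (n G))} → ∣ S ∣ ≤ k → All (Separates G S) Ps →
               ∣ X ∣ ≤ k → W ⊆ X ∪ ⋃ Ps → Large W → Any (λ P → a ≤ ∣ P ∣) Ps
    large-in {X = X} {W = W} {Ps = Ps} ∣S∣≤k seps ∣X∣≤k W⊆X∪⋃Ps large-W
      with Any.any? (λ P → a ≤? ∣ P ∣) Ps
    ... | yes some = some
    ... | no none  = contradiction
      (begin
        ∣ W ∣              ≤⟨ p⊆q⇒∣p∣≤∣q∣ W⊆X∪⋃Ps ⟩
        ∣ X ∪ ⋃ Ps ∣       ≤⟨ ∣p∪q∣≤∣p∣+∣q∣ X (⋃ Ps) ⟩
        ∣ X ∣ + ∣ ⋃ Ps ∣   ≤⟨ m≤o⇒n≤o⇒m+n≤2*o (≤-trans ∣X∣≤k (m≤n+m k a)) (<⇒≤ (≤-trans ∣⋃Ps∣<a (m≤m+n a k))) ⟩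
        2 * (a + k)        ∎)
      (<⇒≱ (Large⇒2[a+k]<∣W∣ {W = W} large-W))
      where
      open ≤-Reasoning
      ∣⋃Ps∣<a : ∣ ⋃ Ps ∣ < a
      ∣⋃Ps∣<a = ⋃-small ∣S∣≤k seps (All.map ≰⇒> (¬Any⇒All¬ Ps none))

    large-member : {I : ℕ} {Q : Pred (Fin I) ℓ} (Q? : Decidable Q) (P : Fin I → Subset (n G)) →
                   ∣ S ∣ ≤ k → (∀ {i} → Q i → Separates G S (P i)) →
                   ∣ X ∣ ≤ k → (∀ {v} → v ∈ W → v ∈ X ⊎ ∃ λ i → Q i × v ∈ P i) → Large W →
                   ∃ λ i → Q i × a ≤ ∣ P i ∣
    large-member {X = X} {I = I} Q? P ∣S∣≤k sep ∣X∣≤k cover large-W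
      with find (large-in ∣S∣≤k seps ∣X∣≤k W⊆X∪⋃Ps large-W)
      where
      Ps = map P (filter Q? (allFin I))
      seps : All (Separates G _) Ps
      seps = All.tabulate λ p∈ → case ∈-map∘filter⁻ P Q? {xs = allFin I} p∈ of λ where
        (i , _ , refl , Qi) → sep Qi
      W⊆X∪⋃Ps : _ ⊆ X ∪ ⋃ Ps
      W⊆X∪⋃Ps v∈W with cover v∈W
      ... | inj₁ v∈X            = p⊆p∪q (⋃ Ps) v∈X
      ... | inj₂ (i , Qi , v∈P) = q⊆p∪q X (⋃ Ps) (x∈⋃⁺ (∈-map∘filter⁺ P Q? (i , ∈-allFin i , refl , Qi)) v∈P)
    ... | p , p∈Ps , a≤∣p∣ with ∈-map∘filter⁻ P Q? {xs = allFin I} p∈Ps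
    ...   | i , _ , refl , Qi = i , Qi , a≤∣p∣

    module _ {L : Subset (n G)} where

      large-component : {W X R : Subset (n G)} → Enclosure G L k W → ∣ X ∣ ≤ k →
                        (∀ {v} → v ∈ R → v ∈ X ⊎ v ∈ W) → Large R →
                        ∃ λ C → IsComponent G L C × a ≤ ∣ C ∣
      large-component {W = W} {X = X} {R = R} E ∣X∣≤k cover large-R
        with large-member {X = X} {W = R} (_∈? W) (componentOf G L)
               ∣boundary∣≤k separated-component ∣X∣≤k cover′ large-R
        where
        open Enclosure E
        separated-component : ∀ {v} → v ∈ W → Separates G boundary (componentOf G L v)
        separated-component {v} v∈W =
          component-separated E (componentOf-isComponent G L (W⊆L v∈W)) (v∈componentOf G L v) v∈W
        cover′ : ∀ {v} → v ∈ R → v ∈ X ⊎ ∃ λ u → u ∈ W × v ∈ componentOf G L u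
        cover′ {v} v∈R = map₂ (λ v∈W → v , v∈W , v∈componentOf G L v) (cover v∈R)
      ... | v , v∈W , a≤∣C∣ = componentOf G L v , componentOf-isComponent G L (Enclosure.W⊆L E v∈W) , a≤∣C∣

      unique-large-component : (∃ λ C → IsComponent G L C × a ≤ ∣ C ∣) →
                               (∀ {v} → v ∈ L → ∃ λ W → v ∈ W × Enclosure G L k W) →
                               Conclusion G L a k
      unique-large-component (C , isC , a≤∣C∣) enclosure =
        inj₂ (C , isC , a≤∣C∣ , unique , m≤n+o⇒m∸n≤o (n G) ∣ C ∣ n≤∣C∣+a+k)
        where
        large-C : ∀ {C′} → IsComponent G L C′ → a ≤ ∣ C′ ∣ → Large C′
        large-C isC′@(C′⊆L , (u , u∈C′) , _) a≤∣C′∣ with enclosure (C′⊆L u∈C′)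
        ... | W , u∈W , E = a≤∣W∣⇒Large (Enclosure.∣boundary∣≤k E) (component-separated E isC′ u∈C′ u∈W) a≤∣C′∣
        n≤∣C∣+a+k : n G ≤ ∣ C ∣ + (a + k)
        n≤∣C∣+a+k = <⇒≤ (subst (n G <_) (+-comm (a + k) ∣ C ∣) (large-C isC a≤∣C∣))
        unique : ∀ C′ → IsComponent G L C′ → a ≤ ∣ C′ ∣ → C′ ≡ C
        unique C′ isC′ a≤∣C′∣ with any? (λ x → x ∈? C′ ×-dec x ∈? C)
        ... | yes (x , x∈C′ , x∈C) = component-≡ isC′ isC x∈C′ x∈C
        ... | no disjoint = contradiction (begin-strict
          n G                  <⟨ large-C isC a≤∣C∣ ⟩
          a + k + ∣ C ∣        ≤⟨ +-monoˡ-≤ ∣ C ∣ (m≤m+n (a + k) _) ⟩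
          2 * (a + k) + ∣ C ∣  <⟨ +-monoˡ-< ∣ C ∣ (Large⇒2[a+k]<∣W∣ {W = C′} (large-C isC′ a≤∣C′∣)) ⟩
          ∣ C′ ∣ + ∣ C ∣       ≤⟨ p⊆∁q⇒∣p∣+∣q∣≤n C′⊆∁C ⟩
          n G                  ∎) (n≮n (n G))
          where
          open ≤-Reasoning
          C′⊆∁C : C′ ⊆ ∁ C
          C′⊆∁C {x} x∈C′ = x∉p⇒x∈∁p λ x∈C → disjoint (x , x∈C′ , x∈C)

  conclusion : {L : Subset (n G)} → (3 * (a + k) < n G → ∃ λ C → IsComponent G L C × a ≤ ∣ C ∣) →
               (∀ {v} → v ∈ L → ∃ λ W → v ∈ W × Enclosure G L k W) →
               Conclusion G L a k
  conclusion large-C enclosure with n G ≤? 3 * (a + k)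
  ... | yes n≤3[a+k] = inj₁ n≤3[a+k]
  ... | no  n≰3[a+k] = unique-large-component (≰⇒> n≰3[a+k]) (large-C (≰⇒> n≰3[a+k])) enclosure

module EliminationDecomposition {ℋ : Family} {G : Graph} (D : ElimDecomp ℋ G)
                                {k : ℕ} (depth : DepthAtMost (forest D) k) where

  private
    F = forest D
    variable
      j f : ℕ
      c c′ s t : Fin (N F)
      v : Fin (n G)

  bag : Fin (n G) → Fin (N F)
  bag v = proj₁ (partition D v)

  ∈bag : ∀ v → v ∈ χ D (bag v)
  ∈bag v = proj₁ (proj₂ (partition D v))

  parent-bag∌L : parent F c ≡ just t → v ∈ χ D t → v ∉ L D
  parent-bag∌L {c} e = proj₂ (internal D _ (λ leaf → leaf c e)) _

  ∣parent-bag∣≤1 : parent F c ≡ just t → ∣ χ D t ∣ ≤ 1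
  ∣parent-bag∣≤1 {c} e = proj₁ (internal D _ (λ leaf → leaf c e))

  bag-leaf : v ∈ L D → IsLeaf F (bag v)
  bag-leaf {v} v∈L c e = parent-bag∌L e (∈bag v) v∈L

  in-subtree? : ∀ t → Decidable (λ v → Anc F t (bag v))
  in-subtree? t v = anc? {F = F} depth t (bag v)

  subtree : Fin (N F) → Subset (n G)
  subtree t = subset (in-subtree? t)

  ∈subtree⁺ : Anc F t (bag v) → v ∈ subtree t
  ∈subtree⁺ {t} = x∈subset⁺ (in-subtree? t)

  ∈subtree⁻ : v ∈ subtree t → Anc F t (bag v)
  ∈subtree⁻ {t = t} = x∈subset⁻ (in-subtree? t)

  ancestorBags : ℕ → Fin (N F) → Subset (n G)
  ancestorBags zero    t = ∅
  ancestorBags (suc f) t = maybe′ (λ p → χ D p ∪ ancestorBags f p) ∅ (parent F t)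

  ancestorBags-siblings : parent F c ≡ parent F c′ → ancestorBags f c ≡ ancestorBags f c′
  ancestorBags-siblings {f = zero}  _ = refl
  ancestorBags-siblings {f = suc f} e = cong (maybe′ _ ∅) e

  ancestorBags-root : parent F t ≡ nothing → ancestorBags f t ≡ ∅
  ancestorBags-root {f = zero}  _ = refl
  ancestorBags-root {f = suc f} e = cong (maybe′ _ ∅) e

  ∣ancestorBags∣≤ : ∀ f t → ∣ ancestorBags f t ∣ ≤ f
  ∣ancestorBags∣≤ zero t = ∣∅∣≤ {n G} 0
  ∣ancestorBags∣≤ (suc f) t with parent F t in e
  ... | nothing = ∣∅∣≤ {n G} (suc f)
  ... | just p  = ≤-trans (∣p∪q∣≤∣p∣+∣q∣ (χ D p) _) (+-mono-≤ (∣parent-bag∣≤1 e) (∣ancestorBags∣≤ f p))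

  ancestorBags∌L : ∀ f t → v ∈ ancestorBags f t → v ∉ L D
  ancestorBags∌L zero    t v∈ = contradiction v∈ ∉⊥
  ancestorBags∌L (suc f) t v∈ with parent F t in e
  ... | nothing = contradiction v∈ ∉⊥
  ... | just p with x∈p∪q⁻ (χ D p) _ v∈
  ...   | inj₁ v∈χp = parent-bag∌L e v∈χp
  ...   | inj₂ v∈   = ancestorBags∌L f p v∈

  χ⊆ancestorBags : AncN F (suc j) s t → suc j ≤ f → χ D s ⊆ ancestorBags f t
  χ⊆ancestorBags {f = suc f} (up {p = p} e a) (s≤s j≤f) {v} v∈χs rewrite e = via-parent a j≤f
    where
    via-parent : AncN F j _ p → j ≤ f → v ∈ χ D p ∪ ancestorBags f p
    via-parent here         _   = p⊆p∪q _ v∈χs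
    via-parent (up e′ a′) j≤f′  = q⊆p∪q (χ D p) _ (χ⊆ancestorBags (up e′ a′) j≤f′ v∈χs)

  -- An edge leaving the subtree of t ends in a bag comparable with, hence above, t.
  subtree-separated : ∀ t → Separates G (ancestorBags k t) (subtree t)
  subtree-separated t = separates leave-subtree
    where
    leave-subtree : ∀ {u w} → u ∈ subtree t → Edge G u w → w ∈ subtree t ⊎ w ∈ ancestorBags k t
    leave-subtree {u} {w} u∈ e with ∈subtree⁻ u∈ | edges D u w (bag u) (bag w) e (∈bag u) (∈bag w)
    ... | _ , a | inj₁ (_ , b) = inj₁ (∈subtree⁺ (_ , anc-trans a b))
    ... | _ , a | inj₂ (_ , b) with anc-comparable a b
    ...   | inj₁ t≤bag-w    = inj₁ (∈subtree⁺ t≤bag-w)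
    ...   | inj₂ (_ , b′)   = inj₂ (χ⊆ancestorBags b′ (depth _ _ _ b′) (∈bag w))

  sibling-separated : parent F c′ ≡ parent F c → Separates G (ancestorBags k c) (subtree c′)
  sibling-separated {c′} e =
    subst (λ S → Separates G S (subtree c′)) (ancestorBags-siblings {f = k} e) (subtree-separated c′)

  root-separated : parent F t ≡ nothing → Separates G ∅ (subtree t)
  root-separated {t} e =
    subst (λ S → Separates G S (subtree t)) (ancestorBags-root {f = k} e) (subtree-separated t)

  leaf-enclosure : IsLeaf F t → Enclosure G (L D) k (subtree t)
  leaf-enclosure {t} leaf = record
    { boundary     = ancestorBags k t
    ; ∣boundary∣≤k = ∣ancestorBags∣≤ k t
    ; separated    = subtree-separated t
    ; W⊆L          = λ {v} v∈ → proj₁ (leaves D t leaf)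
                       (subst (λ s → v ∈ χ D s) (leaf-anc leaf (proj₂ (∈subtree⁻ v∈))) (∈bag v))
    ; boundary∌L   = ancestorBags∌L k t
    }

  enclosure : v ∈ L D → ∃ λ W → v ∈ W × Enclosure G (L D) k W
  enclosure {v} v∈L = subtree (bag v) , ∈subtree⁺ (0 , here) , leaf-enclosure (bag-leaf v∈L)

  module _ {a : ℕ} (unbreakable : Unbreakable a k G) (3[a+k]<n : 3 * (a + k) < n G) where

    open UnbreakableGraph {G = G} unbreakable

    root-large : ∃ λ r → parent F r ≡ nothing × Large (subtree r)
    root-large with large-member 3[a+k]<n {S = ∅} {X = ∅} {W = full}
                     (λ r → ≡-decᵐ _≟ᶠ_ (parent F r) nothing) subtree
                     (∣∅∣≤ {n G} k) root-separated (∣∅∣≤ {n G} k) cover Large-full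
      where
      cover : ∀ {v} → v ∈ full → v ∈ ∅ ⊎ ∃ λ r → parent F r ≡ nothing × v ∈ subtree r
      cover {v} _ with root-anc {F = F} depth (bag v)
      ... | r , e , r≤bag-v = inj₂ (r , e , ∈subtree⁺ r≤bag-v)
    ... | r , e , a≤ = r , e , a≤∣W∣⇒Large (∣∅∣≤ {n G} k) (root-separated {t = r} e) a≤

    child-large : parent F c ≡ just t → Large (subtree t) → ∃ λ c′ → parent F c′ ≡ just t × Large (subtree c′)
    child-large {c} {t} e large-t
      with large-member 3[a+k]<n {X = χ D t} {W = subtree t} (λ c′ → ≡-decᵐ _≟ᶠ_ (parent F c′) (just t)) subtree
             (∣ancestorBags∣≤ k c) (λ e′ → sibling-separated (trans e′ (≡-sym e))) ∣χt∣≤k cover large-t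
      where
      ∣χt∣≤k : ∣ χ D t ∣ ≤ k
      ∣χt∣≤k = ≤-trans (∣parent-bag∣≤1 e) (depth 1 t c (up e here))
      cover : ∀ {v} → v ∈ subtree t → v ∈ χ D t ⊎ ∃ λ c′ → parent F c′ ≡ just t × v ∈ subtree c′
      cover {v} v∈ with ∈subtree⁻ v∈
      ... | zero  , a = inj₁ (subst (λ s → v ∈ χ D s) (anc-zero a) (∈bag v))
      ... | suc j , a with anc-via-child a
      ...   | c′ , e′ , a′ = inj₂ (c′ , e′ , ∈subtree⁺ (j , a′))
    ... | c′ , e′ , a≤ =
      c′ , e′ , a≤∣W∣⇒Large (∣ancestorBags∣≤ k c) (sibling-separated {c′ = c′} (trans e′ (≡-sym e))) a≤

    large-component-exists : ∃ λ C → IsComponent G (L D) C × a ≤ ∣ C ∣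
    large-component-exists =
      let _ , _ , large-r = root-large
          _ , leaf , large-ℓ = descend {F = F} depth (λ t → Large (subtree t)) child-large large-r
      in large-component 3[a+k]<n {X = ∅} (leaf-enclosure leaf) (∣∅∣≤ {n G} k) inj₂ large-ℓ

module TreeDecomposition {ℋ : Family} {G : Graph} (D : TreeDecomp ℋ G)
                         {k : ℕ} (width<k : suc (width D) ≤ k) where

  private
    F = forest D
    variable
      c s t : Fin (N F)
      v : Fin (n G)

  depth : DepthAtMost F (N F)
  depth = acyclic⇒depth (acyclic D)

  ∣χ─L∣≤k : ∀ t → ∣ χ D t ─ L D ∣ ≤ k
  ∣χ─L∣≤k t = ≤-trans (x∈xs⇒x≤foldr⊔ (∈-map⁺ (λ t → ∣ χ D t ─ L D ∣) (∈-allFin t)))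
                      (≤-trans (m≤n+m∸n _ 1) width<k)

  L-bag-unique : v ∈ L D → v ∈ χ D t → v ∈ χ D s → t ≡ s
  L-bag-unique {v} v∈L v∈t v∈s with leafBag D v v∈L
  ... | _ , _ , _ , unique = trans (unique _ v∈t) (≡-sym (unique _ v∈s))

  L-bag-leaf : v ∈ L D → v ∈ χ D t → IsLeaf F t
  L-bag-leaf {v} v∈L v∈t with leafBag D v v∈L
  ... | _ , _ , leaf , unique = subst (IsLeaf F) (≡-sym (unique _ v∈t)) leaf

  in-bag-below? : ∀ t → Decidable (λ v → ∃ λ s → Anc F t s × v ∈ χ D s)
  in-bag-below? t v = any? (λ s → anc? {F = F} depth t s ×-dec v ∈? χ D s)

  below : Fin (N F) → Subset (n G)
  below t = subset (in-bag-below? t)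

  ∈below⁺ : Anc F t s → v ∈ χ D s → v ∈ below t
  ∈below⁺ {t} t≤s v∈s = x∈subset⁺ (in-bag-below? t) (_ , t≤s , v∈s)

  ∈below⁻ : v ∈ below t → ∃ λ s → Anc F t s × v ∈ χ D s
  ∈below⁻ {t = t} = x∈subset⁻ (in-bag-below? t)

  region : Fin (N F) → Subset (n G)
  region t = below t ─ maybe′ (χ D) ∅ (parent F t)

  region-child : parent F c ≡ just t → region c ≡ below c ─ χ D t
  region-child {c} e = cong (λ p → below c ─ maybe′ (χ D) ∅ p) e

  -- The bags containing a vertex outside χ t form a subtree that cannot pass t, so an
  -- edge at such a vertex below a child c of t has both ends in a bag below c.
  child-separated : parent F c ≡ just t → Separates G (χ D t ─ L D) (below c ─ χ D t)
  child-separated {c} {t} e = separates leave-below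
    where
    leave-below : ∀ {u w} → u ∈ below c ─ χ D t → Edge G u w → w ∈ below c ─ χ D t ⊎ w ∈ χ D t ─ L D
    leave-below {u} {w} u∈ uw with ∈below⁻ (p─q⊆p _ _ u∈) | edges D u w uw
    ... | s , c≤s , u∈s | b , u∈b , w∈b with subtree-twalk e (x∈p─q⇒x∉q u∈) (connected D u s b u∈s u∈b) c≤s
    ...   | c≤b with w ∈? χ D t
    ...     | no  w∉t = inj₁ (x∈p∧x∉q⇒x∈p─q (∈below⁺ c≤b w∈b) w∉t)
    ...     | yes w∈t with w ∈? L D
    ...       | no  w∉L = inj₂ (x∈p∧x∉q⇒x∈p─q w∈t w∉L)
    ...       | yes w∈L with c≤b | L-bag-unique w∈L w∈b w∈t
    ...         | j , c≤t | refl = contradiction (up e c≤t) (acyclic D c j)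

  region-separated : parent F c ≡ just t → Separates G (χ D t ─ L D) (region c)
  region-separated e = subst (Separates G _) (≡-sym (region-child e)) (child-separated e)

  bag-enclosure : ∀ t → Enclosure G (L D) k (χ D t ∩ L D)
  bag-enclosure t = record
    { boundary     = χ D t ─ L D
    ; ∣boundary∣≤k = ∣χ─L∣≤k t
    ; separated    = separates leave-bag
    ; W⊆L          = p∩q⊆q (χ D t) (L D)
    ; boundary∌L   = x∈p─q⇒x∉q
    }
    where
    leave-bag : ∀ {u w} → u ∈ χ D t ∩ L D → Edge G u w → w ∈ χ D t ∩ L D ⊎ w ∈ χ D t ─ L D
    leave-bag {u} {w} u∈ uw with x∈p∩q⁻ (χ D t) (L D) u∈ | edges D u w uw
    ... | u∈t , u∈L | b , u∈b , w∈b with L-bag-unique u∈L u∈b u∈t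
    ...   | refl with w ∈? L D
    ...     | yes w∈L = inj₁ (x∈p∩q⁺ (w∈b , w∈L))
    ...     | no  w∉L = inj₂ (x∈p∧x∉q⇒x∈p─q w∈b w∉L)

  enclosure : v ∈ L D → ∃ λ W → v ∈ W × Enclosure G (L D) k W
  enclosure {v} v∈L with leafBag D v v∈L
  ... | ℓ , v∈ℓ , _ = χ D ℓ ∩ L D , x∈p∩q⁺ (v∈ℓ , v∈L) , bag-enclosure ℓ

  module _ {a : ℕ} (unbreakable : Unbreakable a k G) (3[a+k]<n : 3 * (a + k) < n G) where

    open UnbreakableGraph {G = G} unbreakable

    root-large : ∃ λ r → Large (region r)
    root-large with tree D
    ... | r , r-root , unique-root = r , Large-⊆ full⊆region Large-full
      where
      full⊆region : full ⊆ region r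
      full⊆region {v} _ with nonempty D v
      ... | s , v∈s with root-anc {F = F} depth s
      ...   | r′ , r′-root , r′≤s with unique-root r′ r′-root
      ...     | refl = x∈p∧x∉q⇒x∈p─q (∈below⁺ r′≤s v∈s) (subst (λ p → v ∉ maybe′ (χ D) ∅ p) (≡-sym r-root) ∉⊥)

    child-large : parent F c ≡ just t → Large (region t) → ∃ λ c′ → parent F c′ ≡ just t × Large (region c′)
    child-large {c} {t} e large-t
      with large-member 3[a+k]<n {X = χ D t ─ L D} {W = region t}
             (λ c′ → ≡-decᵐ _≟ᶠ_ (parent F c′) (just t)) region
             (∣χ─L∣≤k t) region-separated (∣χ─L∣≤k t) cover large-t
      where
      cover : ∀ {v} → v ∈ region t → v ∈ χ D t ─ L D ⊎ ∃ λ c′ → parent F c′ ≡ just t × v ∈ region c′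
      cover {v} v∈ with ∈below⁻ (p─q⊆p _ _ v∈) | v ∈? χ D t
      ... | _ , _ , _ | yes v∈t with v ∈? L D
      ...   | no  v∉L = inj₁ (x∈p∧x∉q⇒x∈p─q v∈t v∉L)
      ...   | yes v∈L = contradiction e (L-bag-leaf v∈L v∈t c)
      cover {v} v∈ | s , (zero , t≤s) , v∈s | no v∉t =
        contradiction (subst (λ s → v ∈ χ D s) (anc-zero t≤s) v∈s) v∉t
      cover {v} v∈ | s , (suc j , t≤s) , v∈s | no v∉t with anc-via-child t≤s
      ... | c′ , e′ , c′≤s = inj₂ (c′ , e′ , subst (v ∈_) (≡-sym (region-child e′))
                                               (x∈p∧x∉q⇒x∈p─q (∈below⁺ (j , c′≤s) v∈s) v∉t))
    ... | c′ , e′ , a≤ = c′ , e′ , a≤∣W∣⇒Large (∣χ─L∣≤k t) (region-separated e′) a≤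

    leaf-large-component : IsLeaf F t → Large (region t) → ∃ λ C → IsComponent G (L D) C × a ≤ ∣ C ∣
    leaf-large-component {t} leaf = large-component 3[a+k]<n {X = χ D t ─ L D} (bag-enclosure t) (∣χ─L∣≤k t) cover
      where
      cover : ∀ {v} → v ∈ region t → v ∈ χ D t ─ L D ⊎ v ∈ χ D t ∩ L D
      cover {v} v∈ with ∈below⁻ (p─q⊆p _ _ v∈)
      ... | s , (_ , t≤s) , v∈s with subst (λ s → v ∈ χ D s) (leaf-anc leaf t≤s) v∈s | v ∈? L D
      ...   | v∈t | yes v∈L = inj₂ (x∈p∩q⁺ (v∈t , v∈L))
      ...   | v∈t | no  v∉L = inj₁ (x∈p∧x∉q⇒x∈p─q v∈t v∉L)

    large-component-exists : ∃ λ C → IsComponent G (L D) C × a ≤ ∣ C ∣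
    large-component-exists =
      let _ , large-r = root-large
          _ , leaf , large-ℓ = descend {F = F} depth (λ t → Large (region t)) child-large large-r
      in leaf-large-component leaf large-ℓ

mainTheorem5 : (ℋ : Family) → Hereditary ℋ → (k : ℕ) → (α : ℕ → ℕ) →
    (G : Graph) → Unbreakable (α k) k G →
    ((D : ElimDecomp ℋ G) → DepthAtMost (forest D) k → Conclusion G (L D) (α k) k) ×
    ((D : TreeDecomp ℋ G) → suc (width D) ≤ k → Conclusion G (L D) (α k) k)
mainTheorem5 ℋ _ k α G unbreakable =
  (λ D depth → conclusion
     (EliminationDecomposition.large-component-exists D depth unbreakable)
     (EliminationDecomposition.enclosure D depth)) ,
  (λ D width<k → conclusion
     (TreeDecomposition.large-component-exists D width<k unbreakable)
     (TreeDecomposition.enclosure D width<k))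
  where open UnbreakableGraph unbreakable
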